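{- Let $\mathcal{X}$ be a Fitch graph and $(T',t)$ its cotree. If $\mathcal{X}$ contains an arc, then $\mathcal{X}$ is weakly connected (its underlying undirected graph is connected). Moreover, every vertex $x$ of $T'$ with $x\prec v$ for some vertex $v$ with $t(v)=0$ is a leaf of $T'$.
   Context: For an edge-labeled phylogenetic tree $(T,\lambda)$ (root degree $\ge2$, other inner vertices degree $\ge3$, $\lambda:E\to\{0,1\}$), $\mathcal{X}_{(T,\lambda)}$ is the set of pairs $(x,y)$ of distinct leaves such that the path from $\operatorname{lca}(x,y)$ to $y$ contains an edge labeled $1$. A relation is valid if it equals some $\mathcal{X}_{(T,\lambda)}$. A Fitch graph is a loopless digraph whose induced subgraph on any three vertices is valid; Fitch graphs are di-cographs. A di-cograph is built from single vertices by disjoint union, series composition (all arcs in both directions between parts) and order composition (all arcs from first to second part). Its cotree is the unique ordered rooted phylogenetic tree $(T',t)$ with leaf set the vertex set and inner labels $t\in\{0,1,\overrightarrow{1}\}$ (adjacent inner vertices labeled differently), such that $t(\operatorname{lca}(x,y))=0$ if neither $(x,y)$ nor $(y,x)$ is an arc, $1$ if both are, $\overrightarrow{1}$ otherwise (with arc $(x,y)$ when $x$ is left of $y$). $x\prec v$ means $x$ is a proper descendant of $v$. -}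

module Defs where

open import Data.Bool using (Bool; true; false)
open import Data.Nat using (ℕ; _≤_)
open import Data.Fin using (Fin)
open import Data.List using (List; []; _∷_; _++_; length; allFin)
open import Data.List.Membership.Propositional using (_∈_; _∉_)
open import Data.List.Relation.Binary.Permutation.Propositional using (_↭_)
open import Data.Product using (Σ; _×_; _,_; ∃)
open import Data.Sum using (_⊎_)
open import Data.Empty using (⊥)
open import Relation.Nullary using (¬_)
open import Relation.Binary.PropositionalEquality using (_≡_; _≢_)
open import Relation.Binary.Construct.Closure.ReflexiveTransitive using (Star)
open import Relation.Binary.Construct.Closure.Symmetric using (SymClosure)

infix 3 _⟺_
_⟺_ : Set → Set → Set
P ⟺ Q = (P → Q) × (Q → P)

Digraph : ℕ → Set
Digraph n = Fin n → Fin n → Bool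

Arc : ∀ {n} → Digraph n → Fin n → Fin n → Set
Arc G x y = G x y ≡ true

Loopless : ∀ {n} → Digraph n → Set
Loopless G = ∀ x → G x x ≡ false

HasArc : ∀ {n} → Digraph n → Set
HasArc G = ∃ λ x → ∃ λ y → Arc G x y

WeaklyConnected : ∀ {n} → Digraph n → Set
WeaklyConnected G = ∀ u w → Star (SymClosure (Arc G)) u w

-- Edge-labelled phylogenetic trees: every inner vertex has ≥ 2 children
-- (equivalently: root degree ≥ 2, other inner vertices degree ≥ 3).
-- Each child edge carries a label λ ∈ {0,1} (false = 0, true = 1).

data ETree (A : Set) : Set where
  leaf : A → ETree A
  node : (ts : List (Bool × ETree A)) → 2 ≤ length ts → ETree A

module _ {A : Set} where

  mutual
    eleaves : ETree A → List A
    eleaves (leaf a) = a ∷ []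
    eleaves (node ts _) = eleavesF ts

    eleavesF : List (Bool × ETree A) → List A
    eleavesF [] = []
    eleavesF ((b , t) ∷ ts) = eleaves t ++ eleavesF ts

  -- the path from the root of the tree to leaf y contains an edge labelled 1
  mutual
    Path1 : ETree A → A → Set
    Path1 (leaf a) y = ⊥
    Path1 (node ts _) y = Path1F ts y

    Path1F : List (Bool × ETree A) → A → Set
    Path1F [] y = ⊥
    Path1F ((b , t) ∷ ts) y = (y ∈ eleaves t × (b ≡ true ⊎ Path1 t y)) ⊎ Path1F ts y

  SameChild : List (Bool × ETree A) → A → A → Set
  SameChild [] x y = ⊥
  SameChild ((b , t) ∷ ts) x y = (x ∈ eleaves t × y ∈ eleaves t) ⊎ SameChild ts x y

  -- (x , y) ∈ 𝒳_(T,λ): the path from lca(x,y) to y contains an edge labelled 1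
  mutual
    XRel : ETree A → A → A → Set
    XRel (leaf a) x y = ⊥
    XRel (node ts _) x y =
      XRelF ts x y
      ⊎ (x ∈ eleavesF ts × y ∈ eleavesF ts × ¬ SameChild ts x y × Path1F ts y)

    XRelF : List (Bool × ETree A) → A → A → Set
    XRelF [] x y = ⊥
    XRelF ((b , t) ∷ ts) x y = (x ∈ eleaves t × y ∈ eleaves t × XRel t x y) ⊎ XRelF ts x y

ValidTriple : ∀ {n} → Digraph n → Fin n → Fin n → Fin n → Set
ValidTriple {n} G a b c =
  Σ (ETree (Fin n)) λ T →
    (eleaves T ↭ (a ∷ b ∷ c ∷ [])) ×
    (∀ x y → x ∈ (a ∷ b ∷ c ∷ []) → y ∈ (a ∷ b ∷ c ∷ []) → x ≢ y →
       Arc G x y ⟺ XRel T x y)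

Fitch : ∀ {n} → Digraph n → Set
Fitch G = Loopless G ×
  (∀ a b c → a ≢ b → a ≢ c → b ≢ c → ValidTriple G a b c)

-- Cotrees: ordered rooted phylogenetic trees with inner labels 0, 1, →1

data CLabel : Set where
  c0 c1 c→ : CLabel

data CTree (A : Set) : Set where
  leaf : A → CTree A
  node : CLabel → (ts : List (CTree A)) → 2 ≤ length ts → CTree A

module _ {A : Set} where

  mutual
    cleaves : CTree A → List A
    cleaves (leaf a) = a ∷ []
    cleaves (node _ ts _) = cleavesF ts

    cleavesF : List (CTree A) → List A
    cleavesF [] = []
    cleavesF (t ∷ ts) = cleaves t ++ cleavesF ts

  data Child : CTree A → CTree A → Set where
    child : ∀ {ℓ ts p u} → u ∈ ts → Child u (node ℓ ts p)

  data _≺_ : CTree A → CTree A → Set where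
    direct : ∀ {u v} → Child u v → u ≺ v
    below  : ∀ {w u v} → w ≺ u → Child u v → w ≺ v

  _⪯_ : CTree A → CTree A → Set
  x ⪯ v = x ≡ v ⊎ x ≺ v

  data Labeled : CTree A → CLabel → Set where
    labeled : ∀ {ℓ ts p} → Labeled (node ℓ ts p) ℓ

  data IsLeaf : CTree A → Set where
    isLeaf : ∀ {a} → IsLeaf (leaf a)

  LeftOf : List (CTree A) → A → A → Set
  LeftOf [] x y = ⊥
  LeftOf (t ∷ ts) x y = (x ∈ cleaves t × y ∈ cleavesF ts) ⊎ LeftOf ts x y

  IsLca : CTree A → A → A → Set
  IsLca v x y = x ∈ cleaves v × y ∈ cleaves v ×
    (∀ u → Child u v → ¬ (x ∈ cleaves u × y ∈ cleaves u))

  Alternating : CTree A → Set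
  Alternating T = ∀ u v → v ⪯ T → Child u v →
    ∀ ℓ ℓ' → Labeled v ℓ → Labeled u ℓ' → ℓ ≢ ℓ'

IsCotree : ∀ {n} → Digraph n → CTree (Fin n) → Set
IsCotree {n} G T =
  (cleaves T ↭ allFin n) ×
  Alternating T ×
  (∀ x y → x ≢ y → ∀ ℓ ts p → node ℓ ts p ⪯ T → IsLca (node ℓ ts p) x y →
     (ℓ ≡ c0 ⟺ (¬ Arc G x y × ¬ Arc G y x)) ×
     (ℓ ≡ c1 ⟺ (Arc G x y × Arc G y x)) ×
     (ℓ ≡ c→ → (Arc G x y ⟺ LeftOf ts x y)))

module Submission where

-- Both parts rest on one "triangle" property of the relations 𝒳_(T,λ):
-- if (a , b) ∈ 𝒳 and c ≠ b is another leaf, then (c , b) ∈ 𝒳 or (a , c) ∈ 𝒳.  Since every triple of a Fitch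
-- graph is valid, a Fitch graph G inherits it: for distinct a, b, c and an
-- arc a → b, also c → b or a → c.
--
-- Weak connectivity follows at once: every vertex is adjacent to a or b.
-- For the cotree, let v be labelled 0 and suppose some child u of v is an
-- inner vertex.  By alternation u is labelled 1 or →1, so leaves y, z from
-- its first two children satisfy y → z.  A leaf w from another child of v
-- has lca(w , y) = lca(w , z) = v, hence no arcs between w and y, z, which
-- contradicts the triangle property.  So all children of v are leaves, and
-- proper descendants of v are exactly these children.

open import Defs
open import Data.Nat using (ℕ; s≤s; _≤_)
open import Data.Fin using (Fin)
open import Data.Fin.Properties using (_≟_)
open import Data.Product using (Σ; _×_; _,_; proj₁; proj₂)
open import Data.Sum using (_⊎_; inj₁; inj₂; [_,_]′)
import Data.Sum as Sum
open import Data.Empty using (⊥; ⊥-elim)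
open import Data.Bool using (Bool)
open import Data.List using (List; []; _∷_; _++_; length)
open import Data.List.Properties using (++-assoc)
open import Data.List.Membership.Propositional using (_∈_)
open import Data.List.Membership.Propositional.Properties using (∈-++⁺ˡ; ∈-++⁺ʳ; ∈-++⁻; ∈-∃++)
open import Data.List.Relation.Unary.Any using (here; there)
import Data.List.Relation.Unary.All as All
open All using ([]; _∷_)
import Data.List.Relation.Unary.All.Properties as All
open import Data.List.Relation.Unary.AllPairs using ([]; _∷_)
open import Data.List.Relation.Unary.Unique.Propositional using (Unique)
open import Data.List.Relation.Unary.Unique.Propositional.Properties using (allFin⁺)
open import Data.List.Relation.Binary.Disjoint.Propositional using (Disjoint)
open import Data.List.Relation.Binary.Permutation.Propositional using (_↭_; ↭-sym; ↭⇒↭ₛ)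
open import Data.List.Relation.Binary.Permutation.Propositional.Properties using (∈-resp-↭)
import Data.List.Relation.Binary.Permutation.Setoid.Properties as PermutationSetoid
open import Relation.Nullary using (¬_; yes; no)
open import Relation.Binary.PropositionalEquality using (_≡_; _≢_; refl; sym; trans; subst; setoid; ≢-sym)
open import Relation.Binary.Construct.Closure.ReflexiveTransitive using (Star; ε; _◅_; _◅◅_; reverse)
open import Relation.Binary.Construct.Closure.Symmetric using (SymClosure; fwd; bwd; symmetric)

module _ {A : Set} where

  unique-++⁻ : ∀ (xs : List A) {ys} → Unique (xs ++ ys) → Unique xs × Unique ys × Disjoint xs ys
  unique-++⁻ [] u = [] , u , λ ()
  unique-++⁻ (x ∷ xs) (x∉ ∷ u) with unique-++⁻ xs u | All.++⁻ xs x∉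
  ... | uxs , uys , disj | x∉xs , x∉ys = (x∉xs ∷ uxs) , uys , disjoint
    where
    disjoint : Disjoint (x ∷ xs) _
    disjoint (here refl , m) = All.lookup x∉ys m refl
    disjoint (there m , m′) = disj (m , m′)

  unique-resp-↭ : ∀ {xs ys : List A} → xs ↭ ys → Unique xs → Unique ys
  unique-resp-↭ p = PermutationSetoid.Unique-resp-↭ (setoid A) (↭⇒↭ₛ p)

module _ {A : Set} where

  Forest : Set
  Forest = List (Bool × ETree A)

  XRelAtRoot : Forest → A → A → Set
  XRelAtRoot ts x y = x ∈ eleavesF ts × y ∈ eleavesF ts × ¬ SameChild ts x y × Path1F ts y

  path1F-∈ : ∀ (ts : Forest) {y} → Path1F ts y → y ∈ eleavesF ts
  path1F-∈ ((b , t) ∷ ts) (inj₁ (m , _)) = ∈-++⁺ˡ m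
  path1F-∈ ((b , t) ∷ ts) (inj₂ p) = ∈-++⁺ʳ (eleaves t) (path1F-∈ ts p)

  xrelF-target-∈ : ∀ (ts : Forest) {x y} → XRelF ts x y → y ∈ eleavesF ts
  xrelF-target-∈ ((b , t) ∷ ts) (inj₁ (_ , m , _)) = ∈-++⁺ˡ m
  xrelF-target-∈ ((b , t) ∷ ts) (inj₂ r) = ∈-++⁺ʳ (eleaves t) (xrelF-target-∈ ts r)

  sameChild-∈ : ∀ (ts : Forest) {x y} → SameChild ts x y → x ∈ eleavesF ts × y ∈ eleavesF ts
  sameChild-∈ ((b , t) ∷ ts) (inj₁ (mx , my)) = ∈-++⁺ˡ mx , ∈-++⁺ˡ my
  sameChild-∈ ((b , t) ∷ ts) (inj₂ s) with sameChild-∈ ts s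
  ... | mx , my = ∈-++⁺ʳ (eleaves t) mx , ∈-++⁺ʳ (eleaves t) my

  mutual
    xrel⇒path1 : ∀ (t : ETree A) {x y} → XRel t x y → Path1 t y
    xrel⇒path1 (node ts _) (inj₁ r) = xrelF⇒path1F ts r
    xrel⇒path1 (node ts _) (inj₂ (_ , _ , _ , p)) = p

    xrelF⇒path1F : ∀ (ts : Forest) {x y} → XRelF ts x y → Path1F ts y
    xrelF⇒path1F ((b , t) ∷ ts) (inj₁ (_ , my , r)) = inj₁ (my , inj₂ (xrel⇒path1 t r))
    xrelF⇒path1F ((b , t) ∷ ts) (inj₂ r) = inj₂ (xrelF⇒path1F ts r)

  sameChild-trans : ∀ (ts : Forest) {a b c} → Unique (eleavesF ts) →
    SameChild ts a c → SameChild ts c b → SameChild ts a b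
  sameChild-trans ((l , t) ∷ ts) u s₁ s₂ with unique-++⁻ (eleaves t) u
  sameChild-trans ((l , t) ∷ ts) u (inj₁ (ma , _)) (inj₁ (_ , mb)) | _ = inj₁ (ma , mb)
  sameChild-trans ((l , t) ∷ ts) u (inj₁ (_ , mc)) (inj₂ s) | _ , _ , disj = ⊥-elim (disj (mc , proj₁ (sameChild-∈ ts s)))
  sameChild-trans ((l , t) ∷ ts) u (inj₂ s) (inj₁ (mc , _)) | _ , _ , disj = ⊥-elim (disj (mc , proj₂ (sameChild-∈ ts s)))
  sameChild-trans ((l , t) ∷ ts) u (inj₂ s₁) (inj₂ s₂) | _ , uts , _ = inj₂ (sameChild-trans ts uts s₁ s₂)

  separatedChildren : ∀ l (t : ETree A) ts {x y} → Unique (eleavesF ((l , t) ∷ ts)) →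
    x ∈ eleaves t → y ∈ eleavesF ts →
    ¬ SameChild ((l , t) ∷ ts) x y × ¬ SameChild ((l , t) ∷ ts) y x
  separatedChildren l t ts u mx my with unique-++⁻ (eleaves t) u
  ... | _ , _ , disj = sep-xy , sep-yx
    where
    sep-xy : ¬ SameChild ((l , t) ∷ ts) _ _
    sep-xy (inj₁ (_ , my′)) = disj (my′ , my)
    sep-xy (inj₂ s) = disj (mx , proj₁ (sameChild-∈ ts s))
    sep-yx : ¬ SameChild ((l , t) ∷ ts) _ _
    sep-yx (inj₁ (my′ , _)) = disj (my′ , my)
    sep-yx (inj₂ s) = disj (mx , proj₂ (sameChild-∈ ts s))

  xrelAtRoot-there : ∀ l (t : ETree A) ts {x y} → Unique (eleavesF ((l , t) ∷ ts)) →
    XRelAtRoot ts x y → XRelAtRoot ((l , t) ∷ ts) x y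
  xrelAtRoot-there l t ts u (mx , my , notSame , p) with unique-++⁻ (eleaves t) u
  ... | _ , _ , disj = ∈-++⁺ʳ (eleaves t) mx , ∈-++⁺ʳ (eleaves t) my , notSame′ , inj₂ p
    where
    notSame′ : ¬ SameChild ((l , t) ∷ ts) _ _
    notSame′ (inj₁ (mx′ , _)) = disj (mx′ , mx)
    notSame′ (inj₂ s) = notSame s

  -- If the root-to-b path has a 1-edge, then for any other leaf c either the
  -- lca(c , b)-to-b path has one, or the root-to-c path (which shares the
  -- part above lca(c , b)) has one.
  mutual
    path1-split : ∀ (t : ETree A) {b c} → Unique (eleaves t) → Path1 t b → c ∈ eleaves t → c ≢ b →
      XRel t c b ⊎ Path1 t c
    path1-split (node ts _) u p mc c≢b with path1-splitF ts u p mc c≢b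
    ... | inj₁ r = inj₁ (inj₁ r)
    ... | inj₂ (inj₁ r) = inj₁ (inj₂ r)
    ... | inj₂ (inj₂ (r , _)) = inj₂ r

    -- forest version: in the last case c and b share a child, so the
    -- root-to-c path still carries the 1-edge while the pair is not yet in 𝒳
    path1-splitF : ∀ (ts : Forest) {b c} → Unique (eleavesF ts) → Path1F ts b → c ∈ eleavesF ts → c ≢ b →
      XRelF ts c b ⊎ XRelAtRoot ts c b ⊎ (Path1F ts c × SameChild ts c b)
    path1-splitF ((l , t) ∷ ts) u p mc c≢b with unique-++⁻ (eleaves t) u | ∈-++⁻ (eleaves t) mc
    path1-splitF ((l , t) ∷ ts) u (inj₁ (mb , inj₁ l≡1)) _ _ | _ | inj₁ mc =
      inj₂ (inj₂ (inj₁ (mc , inj₁ l≡1) , inj₁ (mc , mb)))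
    path1-splitF ((l , t) ∷ ts) u (inj₁ (mb , inj₂ p)) _ c≢b | ut , _ | inj₁ mc with path1-split t ut p mc c≢b
    ... | inj₁ r = inj₁ (inj₁ (mc , mb , r))
    ... | inj₂ r = inj₂ (inj₂ (inj₁ (mc , inj₂ r) , inj₁ (mc , mb)))
    path1-splitF ((l , t) ∷ ts) u (inj₁ (mb , p)) mc′ _ | _ | inj₂ mc =
      inj₂ (inj₁ (mc′ , ∈-++⁺ˡ mb , proj₂ (separatedChildren l t ts u mb mc) , inj₁ (mb , p)))
    path1-splitF ((l , t) ∷ ts) u (inj₂ p) mc′ _ | _ | inj₁ mc =
      inj₂ (inj₁ (mc′ , ∈-++⁺ʳ (eleaves t) mb , proj₁ (separatedChildren l t ts u mc mb) , inj₂ p))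
      where mb = path1F-∈ ts p
    path1-splitF ((l , t) ∷ ts) u (inj₂ p) _ c≢b | _ , uts , _ | inj₂ mc with path1-splitF ts uts p mc c≢b
    ... | inj₁ r = inj₁ (inj₂ r)
    ... | inj₂ (inj₁ r) = inj₂ (inj₁ (xrelAtRoot-there l t ts u r))
    ... | inj₂ (inj₂ (r , s)) = inj₂ (inj₂ (inj₂ r , inj₂ s))

  mutual
    xrel-triangle : ∀ (t : ETree A) {a b c} → Unique (eleaves t) → XRel t a b → c ∈ eleaves t → c ≢ b →
      XRel t c b ⊎ XRel t a c
    xrel-triangle (node ts _) u (inj₁ r) mc c≢b with xrel-triangleF ts u r mc c≢b
    ... | inj₁ q = inj₁ (inj₁ q)
    ... | inj₂ (inj₁ q) = inj₂ (inj₁ q)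
    ... | inj₂ (inj₂ q) = inj₁ (inj₂ q)
    xrel-triangle (node ts _) u (inj₂ (ma , _ , notSame , p)) mc c≢b with path1-splitF ts u p mc c≢b
    ... | inj₁ q = inj₁ (inj₁ q)
    ... | inj₂ (inj₁ q) = inj₁ (inj₂ q)
    ... | inj₂ (inj₂ (q , s)) =
      inj₂ (inj₂ (ma , mc , (λ s′ → notSame (sameChild-trans ts u s′ s)) , q))

    -- forest version: a new pair may first arise separated at the root of the
    -- forest, which becomes an element of 𝒳 only at the enclosing node
    xrel-triangleF : ∀ (ts : Forest) {a b c} → Unique (eleavesF ts) → XRelF ts a b → c ∈ eleavesF ts → c ≢ b →
      XRelF ts c b ⊎ XRelF ts a c ⊎ XRelAtRoot ts c b
    xrel-triangleF ((l , t) ∷ ts) u r mc c≢b with unique-++⁻ (eleaves t) u | ∈-++⁻ (eleaves t) mc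
    xrel-triangleF ((l , t) ∷ ts) u (inj₁ (ma , mb , r)) _ c≢b | ut , _ | inj₁ mc with xrel-triangle t ut r mc c≢b
    ... | inj₁ q = inj₁ (inj₁ (mc , mb , q))
    ... | inj₂ q = inj₂ (inj₁ (inj₁ (ma , mc , q)))
    xrel-triangleF ((l , t) ∷ ts) u (inj₁ (_ , mb , r)) mc′ _ | _ | inj₂ mc =
      inj₂ (inj₂ (mc′ , ∈-++⁺ˡ mb , proj₂ (separatedChildren l t ts u mb mc) , inj₁ (mb , inj₂ (xrel⇒path1 t r))))
    xrel-triangleF ((l , t) ∷ ts) u (inj₂ r) mc′ _ | _ | inj₁ mc =
      inj₂ (inj₂ (mc′ , ∈-++⁺ʳ (eleaves t) mb , proj₁ (separatedChildren l t ts u mc mb) , inj₂ (xrelF⇒path1F ts r)))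
      where mb = xrelF-target-∈ ts r
    xrel-triangleF ((l , t) ∷ ts) u (inj₂ r) _ c≢b | _ , uts , _ | inj₂ mc with xrel-triangleF ts uts r mc c≢b
    ... | inj₁ q = inj₁ (inj₂ q)
    ... | inj₂ (inj₁ q) = inj₂ (inj₁ (inj₂ q))
    ... | inj₂ (inj₂ q) = inj₂ (inj₂ (xrelAtRoot-there l t ts u q))

arc⇒≢ : ∀ {n} {G : Digraph n} → Loopless G → ∀ {a b} → Arc G a b → a ≢ b
arc⇒≢ loopless {a} ab refl with trans (sym ab) (loopless a)
... | ()

module _ {n : ℕ} {G : Digraph n} (fitch : Fitch G) where

  -- The triangle property transferred to G through the valid triple {a, b, c}.
  fitch-triangle : ∀ {a b c} → a ≢ b → a ≢ c → b ≢ c → Arc G a b → Arc G c b ⊎ Arc G a c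
  fitch-triangle {a} {b} {c} a≢b a≢c b≢c ab =
    Sum.map (proj₂ (arc⟺xrel c∈ b∈ (≢-sym b≢c))) (proj₂ (arc⟺xrel a∈ c∈ a≢c))
      (xrel-triangle T uniqueT (proj₁ (arc⟺xrel a∈ b∈ a≢b) ab) (∈-resp-↭ (↭-sym leaves↭abc) c∈) (≢-sym b≢c))
    where
    valid = proj₂ fitch a b c a≢b a≢c b≢c
    T = proj₁ valid
    leaves↭abc = proj₁ (proj₂ valid)
    arc⟺xrel : ∀ {x y} → x ∈ a ∷ b ∷ c ∷ [] → y ∈ a ∷ b ∷ c ∷ [] → x ≢ y → Arc G x y ⟺ XRel T x y
    arc⟺xrel = proj₂ (proj₂ valid) _ _
    a∈ : a ∈ a ∷ b ∷ c ∷ []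
    a∈ = here refl
    b∈ : b ∈ a ∷ b ∷ c ∷ []
    b∈ = there (here refl)
    c∈ : c ∈ a ∷ b ∷ c ∷ []
    c∈ = there (there (here refl))
    uniqueT : Unique (eleaves T)
    uniqueT = unique-resp-↭ (↭-sym leaves↭abc) ((a≢b ∷ a≢c ∷ []) ∷ (b≢c ∷ []) ∷ [] ∷ [])

  -- Given an arc a → b, every vertex is joined to a in the underlying graph:
  -- by the triangle property it is adjacent to a or to b.
  fitch-linkedTo : ∀ {a b} → Arc G a b → ∀ c → Star (SymClosure (Arc G)) c a
  fitch-linkedTo {a} {b} ab c with c ≟ a | c ≟ b
  ... | yes refl | _ = ε
  ... | no _ | yes refl = bwd ab ◅ ε
  ... | no c≢a | no c≢b with fitch-triangle (arc⇒≢ (proj₁ fitch) ab) (≢-sym c≢a) (≢-sym c≢b) ab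
  ... | inj₁ cb = fwd cb ◅ bwd ab ◅ ε
  ... | inj₂ ac = bwd ac ◅ ε

  fitch-weaklyConnected : HasArc G → WeaklyConnected G
  fitch-weaklyConnected (a , b , ab) u w =
    fitch-linkedTo ab u ◅◅ reverse (symmetric (Arc G)) (fitch-linkedTo ab w)

module _ {A : Set} where

  ∈-cleavesF : ∀ ts {u} {a : A} → u ∈ ts → a ∈ cleaves u → a ∈ cleavesF ts
  ∈-cleavesF (t ∷ ts) (here refl) m = ∈-++⁺ˡ m
  ∈-cleavesF (t ∷ ts) (there k) m = ∈-++⁺ʳ (cleaves t) (∈-cleavesF ts k m)

  cleavesF-++ : ∀ (ts ts′ : List (CTree A)) → cleavesF (ts ++ ts′) ≡ cleavesF ts ++ cleavesF ts′
  cleavesF-++ [] ts′ = refl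
  cleavesF-++ (t ∷ ts) ts′ rewrite cleavesF-++ ts ts′ = sym (++-assoc (cleaves t) (cleavesF ts) (cleavesF ts′))

  someLeaf : (t : CTree A) → Σ A λ a → a ∈ cleaves t
  someLeaf (leaf a) = a , here refl
  someLeaf (node ℓ (t ∷ ts) p) with someLeaf t
  ... | a , m = a , ∈-++⁺ˡ m

  Separated : List (CTree A) → A → A → Set
  Separated ts x y = x ≢ y × (∀ u → u ∈ ts → x ∈ cleaves u → y ∈ cleaves u → ⊥)

  separated-sym : ∀ {ts x y} → Separated ts x y → Separated ts y x
  separated-sym (x≢y , apart) = ≢-sym x≢y , (λ u k my mx → apart u k mx my)

  separated-++ : ∀ ts ts′ {x y} → Unique (cleavesF (ts ++ ts′)) →
    x ∈ cleavesF ts → y ∈ cleavesF ts′ → Separated (ts ++ ts′) x y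
  separated-++ ts ts′ {x} {y} u mx my with unique-++⁻ (cleavesF ts) (subst Unique (cleavesF-++ ts ts′) u)
  ... | _ , _ , disj = (λ { refl → disj (mx , my) }) , apart
    where
    apart : ∀ v → v ∈ ts ++ ts′ → x ∈ cleaves v → y ∈ cleaves v → ⊥
    apart v k mx′ my′ with ∈-++⁻ ts k
    ... | inj₁ k′ = disj (∈-cleavesF ts k′ my′ , my)
    ... | inj₂ k′ = disj (mx , ∈-cleavesF ts′ k′ mx′)

  separated⇒lca : ∀ {ℓ ts p x y} → x ∈ cleavesF ts → y ∈ cleavesF ts →
    Separated ts x y → IsLca (node ℓ ts p) x y
  separated⇒lca mx my (_ , apart) = mx , my , λ { u (child k) (mx′ , my′) → apart u k mx′ my′ }

  leafApartFrom : ∀ ts {u} → u ∈ ts → 2 ≤ length ts → Unique (cleavesF ts) →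
    Σ A λ w → w ∈ cleavesF ts × (∀ y → y ∈ cleaves u → Separated ts w y)
  leafApartFrom ts k p u with ∈-∃++ k
  leafApartFrom .(_ ∷ []) k (s≤s ()) u | [] , [] , refl
  leafApartFrom .(t ∷ t′ ∷ ts′) {t} k p u | [] , t′ ∷ ts′ , refl with someLeaf t′
  ... | w , mw = w , ∈-++⁺ʳ (cleaves t) (∈-++⁺ˡ mw) ,
      λ y my → separated-sym (separated-++ (t ∷ []) (t′ ∷ ts′) u (∈-++⁺ˡ my) (∈-++⁺ˡ mw))
  leafApartFrom .(t′ ∷ ts′ ++ t ∷ ts″) {t} k p u | t′ ∷ ts′ , ts″ , refl with someLeaf t′
  ... | w , mw = w , ∈-++⁺ˡ mw ,
      λ y my → separated-++ (t′ ∷ ts′) (t ∷ ts″) u (∈-++⁺ˡ mw) (∈-++⁺ˡ my)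

  unique-child : ∀ {u v : CTree A} → Unique (cleaves v) → Child u v → Unique (cleaves u)
  unique-child u (child k) = go _ u k
    where
    go : ∀ ts {t} → Unique (cleavesF ts) → t ∈ ts → Unique (cleaves t)
    go (t ∷ ts) u (here refl) = proj₁ (unique-++⁻ (cleaves t) u)
    go (t ∷ ts) u (there k) = go ts (proj₁ (proj₂ (unique-++⁻ (cleaves t) u))) k

  unique-⪯ : ∀ {x v : CTree A} → Unique (cleaves v) → x ⪯ v → Unique (cleaves x)
  unique-⪯ u (inj₁ refl) = u
  unique-⪯ u (inj₂ x≺v) = go u x≺v
    where
    go : ∀ {x v} → Unique (cleaves v) → x ≺ v → Unique (cleaves x)
    go u (direct c) = unique-child u c
    go u (below x≺w c) = go (unique-child u c) x≺w

  ≺-trans : ∀ {a b c : CTree A} → a ≺ b → b ≺ c → a ≺ c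
  ≺-trans a≺b (direct c) = below a≺b c
  ≺-trans a≺b (below b≺w c) = below (≺-trans a≺b b≺w) c

  child-⪯ : ∀ {u v T : CTree A} → v ⪯ T → Child u v → u ⪯ T
  child-⪯ (inj₁ refl) c = inj₂ (direct c)
  child-⪯ (inj₂ v≺T) c = inj₂ (≺-trans (direct c) v≺T)

  ≺-leaf : ∀ {x : CTree A} {a} → ¬ x ≺ leaf a
  ≺-leaf (direct ())
  ≺-leaf (below _ ())

  descendants-of-leaf-parent : ∀ {v x : CTree A} → (∀ {u} → Child u v → IsLeaf u) → x ≺ v → IsLeaf x
  descendants-of-leaf-parent leafChildren (direct c) = leafChildren c
  descendants-of-leaf-parent leafChildren (below x≺u c) with leafChildren c
  ... | isLeaf = ⊥-elim (≺-leaf x≺u)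

module _ {n : ℕ} {G : Digraph n} {T′ : CTree (Fin n)} (cotree : IsCotree G T′) where

  cotree-unique : Unique (cleaves T′)
  cotree-unique = unique-resp-↭ (↭-sym (proj₁ cotree)) (allFin⁺ n)

  lca-c0⇒noArc : ∀ {x y ts p} → node c0 ts p ⪯ T′ → x ≢ y → IsLca (node c0 ts p) x y →
    ¬ Arc G x y × ¬ Arc G y x
  lca-c0⇒noArc {x} {y} {ts} {p} v⪯ x≢y lca =
    proj₁ (proj₁ (proj₂ (proj₂ cotree) x y x≢y c0 ts p v⪯ lca)) refl

  lca-nonzero⇒arc : ∀ {ℓ x y ts p} → node ℓ ts p ⪯ T′ → c0 ≢ ℓ → x ≢ y →
    IsLca (node ℓ ts p) x y → LeftOf ts x y → Arc G x y
  lca-nonzero⇒arc {c0} _ c0≢ℓ _ _ _ = ⊥-elim (c0≢ℓ refl)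
  lca-nonzero⇒arc {c1} {x} {y} {ts} {p} v⪯ _ x≢y lca _ =
    proj₁ (proj₁ (proj₁ (proj₂ (proj₂ (proj₂ cotree) x y x≢y c1 ts p v⪯ lca))) refl)
  lca-nonzero⇒arc {c→} {x} {y} {ts} {p} v⪯ _ x≢y lca left =
    proj₂ (proj₂ (proj₂ (proj₂ (proj₂ cotree) x y x≢y c→ ts p v⪯ lca)) refl) left

  -- An inner vertex not labelled 0 contains distinct leaves y, z with an
  -- arc y → z (taken from its first two children).
  nonzero-inner⇒arc : ∀ {ℓ ts p} → node ℓ ts p ⪯ T′ → c0 ≢ ℓ →
    Σ (Fin n) λ y → Σ (Fin n) λ z → y ≢ z × y ∈ cleavesF ts × z ∈ cleavesF ts × Arc G y z
  nonzero-inner⇒arc {ts = _ ∷ []} {p = s≤s ()}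
  nonzero-inner⇒arc {ts = t₁ ∷ t₂ ∷ ts} u⪯ c0≢ℓ =
    y , z , proj₁ sep , y∈ , z∈ ,
    lca-nonzero⇒arc u⪯ c0≢ℓ (proj₁ sep) (separated⇒lca y∈ z∈ sep) (inj₁ (my , ∈-++⁺ˡ mz))
    where
    y = proj₁ (someLeaf t₁)
    my = proj₂ (someLeaf t₁)
    z = proj₁ (someLeaf t₂)
    mz = proj₂ (someLeaf t₂)
    y∈ = ∈-++⁺ˡ my
    z∈ = ∈-++⁺ʳ (cleaves t₁) (∈-++⁺ˡ mz)
    sep : Separated (t₁ ∷ t₂ ∷ ts) y z
    sep = separated-++ (t₁ ∷ []) (t₂ ∷ ts) (unique-⪯ cotree-unique u⪯) (∈-++⁺ˡ my) (∈-++⁺ˡ mz)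

  -- In the cotree of a Fitch graph, all children of a 0-labelled vertex are
  -- leaves: an inner child would yield an arc y → z between leaves that are
  -- both non-adjacent to a leaf w of another child, against the triangle property.
  c0-children-are-leaves : Fitch G → ∀ {ts p u} → node c0 ts p ⪯ T′ → Child u (node c0 ts p) → IsLeaf u
  c0-children-are-leaves _ _ (child {u = leaf _} _) = isLeaf
  c0-children-are-leaves fitch {ts} {p} v⪯ (child {u = node ℓ us _} k)
    with nonzero-inner⇒arc (child-⪯ v⪯ (child k)) (proj₁ (proj₂ cotree) _ _ v⪯ (child k) c0 ℓ labeled labeled)
       | leafApartFrom ts k p (unique-⪯ cotree-unique v⪯)
  ... | y , z , y≢z , y∈u , z∈u , yz | w , w∈ , apart =
    ⊥-elim ([ proj₁ (noArc z∈u) , proj₂ (noArc y∈u) ]′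
              (fitch-triangle fitch y≢z (≢-sym (proj₁ (apart y y∈u))) (≢-sym (proj₁ (apart z z∈u))) yz))
    where
    -- every leaf x of u has lca(w , x) = v, which is labelled 0
    noArc : ∀ {x} → x ∈ cleavesF us → ¬ Arc G w x × ¬ Arc G x w
    noArc x∈u = lca-c0⇒noArc v⪯ (proj₁ (apart _ x∈u)) (separated⇒lca w∈ (∈-cleavesF ts k x∈u) (apart _ x∈u))

corollary1 : ∀ {n : ℕ} (G : Digraph n) → Fitch G →
    (HasArc G → WeaklyConnected G) ×
    (∀ (T' : CTree (Fin n)) → IsCotree G T' →
       ∀ (v x : CTree (Fin n)) → v ⪯ T' → Labeled v c0 → x ≺ v → IsLeaf x)
corollary1 G fitch = fitch-weaklyConnected fitch , belowZeroIsLeaf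
  where
  belowZeroIsLeaf : ∀ T′ → IsCotree G T′ → ∀ v x → v ⪯ T′ → Labeled v c0 → x ≺ v → IsLeaf x
  belowZeroIsLeaf _ cotree _ _ v⪯ labeled =
    descendants-of-leaf-parent (c0-children-are-leaves cotree fitch v⪯)
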